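{- There exists a 2-B1F of the circulant graph $Circ(8,\{1,2\})$.
   Context: For a positive integer $N$ and $D\subseteq\{1,\dots,\lfloor N/2\rfloor\}$, the circulant graph $Circ(N,D)$ has vertex set $\mathbb{Z}_N$, with $u,v$ adjacent iff $u-v\equiv \pm d \pmod N$ for some $d\in D$. A 1-factor of a graph is a 1-regular spanning subgraph; a 1-factorisation is a partition of the edge set into 1-factors. For two 1-factors of a 1-factorisation, their union is a disjoint union of cycles; the pair has type $[c_1,\dots,c_t]$ (a multiset) if the union consists of $t$ cycles of lengths $c_1,\dots,c_t$. If $T_1,\dots,T_m$ are the distinct types occurring among all unordered pairs of distinct 1-factors of a 1-factorisation $\mathcal{F}$, and each $T_i$ occurs for the same number of pairs, then $\mathcal{F}$ is an $m$-balanced 1-factorisation ($m$-B1F). -}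

module Defs where

open import Data.Nat using (ℕ; zero; suc; _+_; _%_; _≤_; _<_)
open import Data.Nat.Properties using (≤-decTotalOrder)
open import Data.Fin using (Fin; toℕ; _≟_) renaming (_≤?_ to _≤ᶠ?_; _<?_ to _<ᶠ?_)
open import Data.Bool using (Bool; true; false; _∨_; _∧_; if_then_else_)
open import Data.List using (List; []; _∷_; length; map; filter; filterᵇ; cartesianProduct)
open import Data.List.Membership.Propositional using (_∈_)
open import Data.List.Sort.InsertionSort.Base ≤-decTotalOrder using (sort)
open import Data.Fin.Base using () renaming (_<_ to _<ᶠ_)
open import Data.Vec.Functional using ()
open import Data.Product using (Σ; _×_; _,_; ∃; proj₁; proj₂)
open import Data.Sum using (_⊎_)
open import Relation.Nullary using (¬_; does)
open import Relation.Binary.PropositionalEquality using (_≡_; _≢_)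
open import Function.Definitions using (Injective)
import Data.List as L
import Data.List.Properties as LP
import Data.Nat

-- Vertices are Fin N (= ℤ_N); the connection set D is
-- given as a list of naturals (intended to lie in {1,…,⌊N/2⌋}).
-- u ~ v  iff  v ≡ u + d  or  u ≡ v + d  (mod N) for some d ∈ D,
-- i.e. u - v ≡ ± d (mod N).

CircAdj : (N : ℕ) .{{_ : Data.Nat.NonZero N}} → List ℕ → Fin N → Fin N → Set
CircAdj N D u v =
  Σ ℕ λ d → d ∈ D ×
    ((toℕ v ≡ (toℕ u + d) % N) ⊎ (toℕ u ≡ (toℕ v + d) % N))

-- A 1-factor (perfect matching) of a graph with adjacency relation Adj
-- on vertex set Fin N, represented by its partner function m:
-- every vertex v is matched to m v, m v ≠ v, m (m v) = v, and
-- {v , m v} is an edge of the graph.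

record IsOneFactor {N : ℕ} (Adj : Fin N → Fin N → Set)
                   (m : Fin N → Fin N) : Set where
  field
    involutive : ∀ v → m (m v) ≡ v
    noFixed    : ∀ v → m v ≢ v
    isEdge     : ∀ v → Adj v (m v)

record IsOneFactorisation {N : ℕ} (Adj : Fin N → Fin N → Set)
                          (k : ℕ) (F : Fin k → Fin N → Fin N) : Set where
  field
    factors  : ∀ i → IsOneFactor Adj (F i)
    covers   : ∀ u v → Adj u v → Σ (Fin k) λ i → F i u ≡ v
    disjoint : ∀ i j v → F i v ≡ F j v → i ≡ j

-- The union is the graph on Fin N in which the neighbours of w are f w
-- and g w.  reach n f g v w = "w is at distance ≤ n from v" in it
-- (breadth-first closure); reach N gives the connected component of v.

reach : {N : ℕ} → ℕ → (Fin N → Fin N) → (Fin N → Fin N) → Fin N → Fin N → Bool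
reach zero    f g v w = does (w ≟ v)
reach (suc n) f g v w = reach n f g v w ∨ reach n f g v (f w) ∨ reach n f g v (g w)

inComponent : {N : ℕ} → (Fin N → Fin N) → (Fin N → Fin N) → Fin N → Fin N → Bool
inComponent {N} f g v w = reach N f g v w

-- number of vertices (= length, the component being a cycle) of the
-- component containing v
componentSize : {N : ℕ} → (Fin N → Fin N) → (Fin N → Fin N) → Fin N → ℕ
componentSize {N} f g v = length (filterᵇ (inComponent f g v) (L.allFin N))

allᵇ : {A : Set} → (A → Bool) → List A → Bool
allᵇ p []       = true
allᵇ p (x ∷ xs) = p x ∧ allᵇ p xs

isLeader : {N : ℕ} → (Fin N → Fin N) → (Fin N → Fin N) → Fin N → Bool
isLeader {N} f g v =
  allᵇ (λ w → if inComponent f g v w then does (v ≤ᶠ? w) else true) (L.allFin N)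

-- The type of the pair {f, g}: the multiset of lengths of the cycles
-- of f ∪ g, represented canonically as a sorted list (one entry per
-- component).
pairType : {N : ℕ} → (Fin N → Fin N) → (Fin N → Fin N) → List ℕ
pairType {N} f g = sort (map (componentSize f g) (filterᵇ (isLeader f g) (L.allFin N)))

pairs : (k : ℕ) → List (Fin k × Fin k)
pairs k = filter (λ p → proj₁ p <ᶠ? proj₂ p) (cartesianProduct (L.allFin k) (L.allFin k))

countType : {N k : ℕ} → (Fin k → Fin N → Fin N) → List ℕ → ℕ
countType {k = k} F T =
  length (filter (λ p → LP.≡-dec Data.Nat._≟_ (pairType (F (proj₁ p)) (F (proj₂ p))) T) (pairs k))

IsBalanced : {N k : ℕ} → ℕ → (Fin k → Fin N → Fin N) → Set
IsBalanced {N} {k} m F =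
  Σ (Fin m → List ℕ) λ T →
    Injective _≡_ _≡_ T ×
    (∀ (i j : Fin k) → i <ᶠ j → Σ (Fin m) λ a → pairType (F i) (F j) ≡ T a) ×
    (∀ a → Σ (Fin k) λ i → Σ (Fin k) λ j → i <ᶠ j × pairType (F i) (F j) ≡ T a) ×
    Σ ℕ (λ c → ∀ a → countType F (T a) ≡ c)

HasMB1F : {N : ℕ} → ℕ → (Fin N → Fin N → Set) → Set
HasMB1F {N} m Adj =
  Σ ℕ λ k → Σ (Fin k → Fin N → Fin N) λ F →
    IsOneFactorisation Adj k F × IsBalanced m F

-- The edges of difference 1 form the 8-cycle 0 1 … 7, which splits into the
-- matchings {v, v+1} with v even, resp. v odd; the edges of difference 2 form
-- the 4-cycles on the even and on the odd vertices, and taking complementary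
-- matchings of these two 4-cycles gives the two remaining factors.  Each
-- difference-2 factor forms two 4-cycles with the other one and with the
-- "even" difference-1 factor, and an 8-cycle with the "odd" one, as do the two
-- difference-1 factors together: three pairs of type [4,4], three of type [8].
module Submission where

open import Defs
open import Data.Nat using (ℕ; NonZero; _+_; _%_)
import Data.Nat as ℕ
open import Data.Fin using (Fin; toℕ; #_; _≟_; _<_)
open import Data.Fin.Properties using (all?; any?; _<?_)
open import Data.List using (List; []; _∷_)
open import Data.List.Properties using (≡-dec)
open import Data.List.Membership.Propositional using (find; lose)
open import Data.List.Relation.Unary.Any using () renaming (any? to anyᴸ?)
open import Data.Product using (∃; ∃₂; _×_; _,_)
open import Data.Vec using (_∷_; []; lookup)
open import Relation.Binary.Definitions using (Decidable)
open import Relation.Nullary.Decidable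
  using (Dec; from-yes; map′; ¬?; _×-dec_; _⊎-dec_; _→-dec_)
open import Relation.Binary.PropositionalEquality using (_≡_; _≢_)

circAdj? : ∀ N .{{_ : NonZero N}} (D : List ℕ) → Decidable (CircAdj N D)
circAdj? N D u v =
  map′ find (λ (d , d∈D , p) → lose d∈D p)
    (anyᴸ? (λ d → (toℕ v ℕ.≟ (toℕ u + d) % N) ⊎-dec (toℕ u ℕ.≟ (toℕ v + d) % N)) D)

Circ₈ : Fin 8 → Fin 8 → Set
Circ₈ = CircAdj 8 (1 ∷ 2 ∷ [])

circ₈? : Decidable Circ₈
circ₈? = circAdj? 8 (1 ∷ 2 ∷ [])

-- Factors 0 and 2 use the edges of difference 2, factors 1 and 3 those of
-- difference 1 starting at an even resp. odd vertex.
factor : Fin 4 → Fin 8 → Fin 8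
factor = lookup
  ( lookup (# 6 ∷ # 7 ∷ # 4 ∷ # 5 ∷ # 2 ∷ # 3 ∷ # 0 ∷ # 1 ∷ [])
  ∷ lookup (# 1 ∷ # 0 ∷ # 3 ∷ # 2 ∷ # 5 ∷ # 4 ∷ # 7 ∷ # 6 ∷ [])
  ∷ lookup (# 2 ∷ # 3 ∷ # 0 ∷ # 1 ∷ # 6 ∷ # 7 ∷ # 4 ∷ # 5 ∷ [])
  ∷ lookup (# 7 ∷ # 2 ∷ # 1 ∷ # 4 ∷ # 3 ∷ # 6 ∷ # 5 ∷ # 0 ∷ [])
  ∷ [])

factor-involutive : ∀ i v → factor i (factor i v) ≡ v
factor-involutive = from-yes (all? λ i → all? λ v → factor i (factor i v) ≟ v)

factor-noFixed : ∀ i v → factor i v ≢ v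
factor-noFixed = from-yes (all? λ i → all? λ v → ¬? (factor i v ≟ v))

factor-isEdge : ∀ i v → Circ₈ v (factor i v)
factor-isEdge = from-yes (all? λ i → all? λ v → circ₈? v (factor i v))

factor-isOneFactor : ∀ i → IsOneFactor Circ₈ (factor i)
factor-isOneFactor i = record
  { involutive = factor-involutive i
  ; noFixed    = factor-noFixed i
  ; isEdge     = factor-isEdge i
  }

factor-isOneFactorisation : IsOneFactorisation Circ₈ 4 factor
factor-isOneFactorisation = record
  { factors  = factor-isOneFactor
  ; covers   = from-yes (all? λ u → all? λ v →
                 circ₈? u v →-dec any? λ i → factor i u ≟ v)
  ; disjoint = from-yes (all? λ i → all? λ j → all? λ v →
                 (factor i v ≟ factor j v) →-dec (i ≟ j))
  }

cycleType : Fin 2 → List ℕ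
cycleType = lookup ((4 ∷ 4 ∷ []) ∷ (8 ∷ []) ∷ [])

_≟ᴸ_ : (xs ys : List ℕ) → Dec (xs ≡ ys)
_≟ᴸ_ = ≡-dec ℕ._≟_

cycleType-injective : ∀ a b → cycleType a ≡ cycleType b → a ≡ b
cycleType-injective = from-yes (all? λ a → all? λ b →
  (cycleType a ≟ᴸ cycleType b) →-dec (a ≟ b))

pairType-cases : ∀ i j → i < j → ∃ λ a → pairType (factor i) (factor j) ≡ cycleType a
pairType-cases = from-yes (all? λ i → all? λ j → (i <? j) →-dec any? λ a →
  pairType (factor i) (factor j) ≟ᴸ cycleType a)

cycleType-occurs : ∀ a → ∃₂ λ i j → i < j × pairType (factor i) (factor j) ≡ cycleType a
cycleType-occurs = from-yes (all? λ a → any? λ i → any? λ j →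
  (i <? j) ×-dec (pairType (factor i) (factor j) ≟ᴸ cycleType a))

cycleType-count : ∀ a → countType factor (cycleType a) ≡ 3
cycleType-count = from-yes (all? λ a → countType factor (cycleType a) ℕ.≟ 3)

factor-isBalanced : IsBalanced 2 factor
factor-isBalanced =
    cycleType
  , (λ {a} {b} → cycleType-injective a b)
  , pairType-cases
  , cycleType-occurs
  , 3 , cycleType-count

mainTheorem8 : HasMB1F 2 (CircAdj 8 (1 ∷ 2 ∷ []))
mainTheorem8 = 4 , factor , factor-isOneFactorisation , factor-isBalanced
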